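{- Let $C\ge1$ be an integer. There exists a countable collection $\mathcal{X}$ of infinite subsets of $\mathbb{N}$ such that for every algorithm with speed $C$ that generates in the limit, the adversary can choose a target $K\in\mathcal{X}$ and an enumeration of $K$ such that the set $O$ of generated strings has lower Banach density $\delta_B(O,K)=0$.
   Context: Generation game with speed $C$: the adversary picks $K\in\mathcal{X}$ and reveals one string $w_t\in K$ per time step $t$, every element of $K$ eventually revealed; at each time step the algorithm, having seen $S_t=\{w_1,\dots,w_t\}$, outputs up to $C$ strings; it generates in the limit if after some finite time all its outputs lie in $K\setminus S_t$. $O$ is the set of all strings ever output. For infinite $B=\{b_1<b_2<\cdots\}\subseteq\mathbb{N}$ and $A\subseteq\mathbb{N}$, $\delta_B(A,B)=\liminf_{k\to\infty}\inf_{m\ge1}\frac{|\{i:m\le i\le m+k-1,\ b_i\in A\}|}{k}$. -}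

module Defs where

open import Data.Nat using (ℕ; zero; suc; _+_; _*_; _≤_; _<_)
open import Data.Bool using (Bool; true; false; if_then_else_)
open import Data.List using (List; []; _∷_; map; length; upTo)
open import Data.List.Membership.Propositional using (_∈_)
open import Data.Product using (Σ; ∃; _×_; _,_)
open import Relation.Nullary using (¬_)
open import Relation.Binary.PropositionalEquality using (_≡_)

-- Strings are identified with natural numbers.
-- A subset of ℕ is given by its characteristic function.
Subset : Set
Subset = ℕ → Bool

Collection : Set
Collection = ℕ → Subset

Infinite : Subset → Set
Infinite K = ∀ n → ∃ λ x → n ≤ x × K x ≡ true

-- An enumeration (presentation) of K by the adversary: w t is revealed at
-- (0-indexed) time step t; every w t lies in K and every element of K is revealed.
Enumerates : (ℕ → ℕ) → Subset → Set
Enumerates w K = (∀ t → K (w t) ≡ true) × (∀ x → K x ≡ true → ∃ λ t → w t ≡ x)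

history : (ℕ → ℕ) → ℕ → List ℕ
history w t = map w (upTo (suc t))

InS : (ℕ → ℕ) → ℕ → ℕ → Set
InS w t x = ∃ λ i → i ≤ t × w i ≡ x

Algorithm : Set
Algorithm = List ℕ → List ℕ

HasSpeed : ℕ → Algorithm → Set
HasSpeed C A = ∀ h → length (A h) ≤ C

outputs : Algorithm → (ℕ → ℕ) → ℕ → List ℕ
outputs A w t = A (history w t)

GeneratesInLimit : Collection → Algorithm → Set
GeneratesInLimit X A =
  ∀ j (w : ℕ → ℕ) → Enumerates w (X j) →
    ∃ λ T → ∀ t → T ≤ t → ∀ x → x ∈ outputs A w t →
      (X j x ≡ true) × ¬ InS w t x

InO : Algorithm → (ℕ → ℕ) → ℕ → Set
InO A w x = ∃ λ t → x ∈ outputs A w t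

countBelow : Subset → ℕ → ℕ
countBelow K zero = 0
countBelow K (suc b) = (if K b then 1 else 0) + countBelow K b

IsNth : Subset → ℕ → ℕ → Set
IsNth K i b = (K b ≡ true) × (countBelow K b ≡ i)

data CountIn (P : ℕ → Set) : List ℕ → ℕ → Set where
  c-nil  : CountIn P [] 0
  c-yes  : ∀ {x xs c} → P x → CountIn P xs c → CountIn P (x ∷ xs) (suc c)
  c-no   : ∀ {x xs c} → ¬ P x → CountIn P xs c → CountIn P (x ∷ xs) c

window : ℕ → ℕ → List ℕ
window m k = map (m +_) (upTo k)

-- δ_B(A , K) = 0, with K = {b_0 < b_1 < …} infinite and A a predicate:
-- liminf_k inf_m |{i ∈ [m, m+k-1] : b_i ∈ A}| / k = 0, i.e. for every
-- ε = 1/n (n ≥ 1) and every k₀ there are k ≥ k₀ and m with count·n < k.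
BanachDensityZero : (ℕ → Set) → Subset → Set
BanachDensityZero A K =
  ∀ n → 1 ≤ n → ∀ k₀ → ∃ λ k → k₀ ≤ k × ∃ λ m → ∃ λ c →
    CountIn (λ i → ∃ λ b → IsNth K i b × A b) (window m k) c × n * c < k

-- Cut ℕ into consecutive blocks of sizes 1, 2, 3, …; the level of an element is its position in
-- its block.  The collection consists of ℕ and of every set {x : level x ≤ i} ∪ F, F finite.
-- Against a fixed algorithm A, an adversary of rank i extends any finite prefix to an enumeration
-- of such a level-i world having, beyond any bound, a clean block: up to some time A has output no
-- element of the block before revealing it, and by then positions 1..i of the block are revealed.
-- Rank i + 1 runs rank-i adversaries in stages, each followed by revealing position i + 1 of its
-- block.  A generates the resulting world, so from some time T on it only outputs unrevealed
-- elements of level ≤ i + 1, and the block of a stage after T stays clean one step longer.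
-- Running the stages against ℕ with rank s at stage s, positions 1..s of a stage-s block (s ≥ T)
-- are never output: such an output would already be revealed, which generation forbids after T,
-- while before T nothing of the block is revealed.  So O misses arbitrarily long windows of ℕ and
-- δ_B(O, ℕ) = 0.

module Submission where

open import Defs
open import Data.Bool using (true; false; if_then_else_)
open import Data.Empty using (⊥-elim)
open import Data.List using (List; []; _∷_; _++_; map; concat; upTo)
open import Data.List.Extrema.Nat using (max; xs≤max)
open import Data.List.Membership.Propositional using (_∈_)
open import Data.List.Membership.Propositional.Properties
  using (∈-map⁺; ∈-map⁻; ∈-upTo⁺; ∈-upTo⁻; ∈-++⁺ˡ; ∈-++⁺ʳ; ∈-concat⁺′)
open import Data.List.Properties using (map-cong-local)
import Data.List.Relation.Unary.All as All
open import Data.Nat using (ℕ; zero; suc; _+_; _≤_; _<_; _≤′_; ≤′-refl; ≤′-step; _≟_; _≤?_; z≤n; s≤s)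
open import Data.List.Membership.DecPropositional _≟_ using (_∈?_)
open import Data.Nat.Binary using (ℕᵇ; 2[1+_]; 1+[2_]; toℕ; fromℕ) renaming (zero to 0ᵇ)
open import Data.Nat.Binary.Properties using (fromℕ-toℕ)
open import Data.Nat.Properties
open import Data.Product using (∃; _×_; _,_; proj₁; proj₂)
open import Data.Sum using (_⊎_; inj₁; inj₂; [_,_]′)
open import Function using (_∘_)
open import Relation.Nullary using (¬_; Dec; yes; does)
open import Relation.Nullary.Decidable using (dec-true; dec-false; _⊎-dec_)
open import Relation.Binary.PropositionalEquality
  using (_≡_; refl; sym; trans; cong; subst; module ≡-Reasoning)

AgreeBelow : ℕ → (ℕ → ℕ) → (ℕ → ℕ) → Set
AgreeBelow n f g = ∀ t → t < n → f t ≡ g t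

splice : (ℕ → ℕ) → ℕ → (ℕ → ℕ) → ℕ → ℕ
splice f zero    g t       = g t
splice f (suc L) g zero    = f zero
splice f (suc L) g (suc t) = splice (f ∘ suc) L g t

splice-< : ∀ f L g → AgreeBelow L (splice f L g) f
splice-< f (suc L) g zero    _       = refl
splice-< f (suc L) g (suc t) (s≤s h) = splice-< (f ∘ suc) L g t h

splice-+ : ∀ f L g u → splice f L g (L + u) ≡ g u
splice-+ f zero    g u = refl
splice-+ f (suc L) g u = splice-+ (f ∘ suc) L g u

splice-All : ∀ {P : ℕ → Set} f L g →
             (∀ t → t < L → P (f t)) → (∀ u → P (g u)) → ∀ t → P (splice f L g t)
splice-All     f zero    g _  hg t       = hg t
splice-All     f (suc L) g hf _  zero    = hf 0 (s≤s z≤n)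
splice-All {P} f (suc L) g hf hg (suc t) = splice-All {P} (f ∘ suc) L g (λ t h → hf (suc t) (s≤s h)) hg t

module PrefixLimit (pre : ℕ → ℕ → ℕ) (len : ℕ → ℕ)
                   (coherent : ∀ s → AgreeBelow (len s) (pre (suc s)) (pre s))
                   (len-mono : ∀ s → len s ≤ len (suc s))
                   (len-unbounded : ∀ s → s ≤ len s) where

  limit : ℕ → ℕ
  limit t = pre (suc t) t

  len-monotone : ∀ {s s'} → s ≤′ s' → len s ≤ len s'
  len-monotone ≤′-refl     = ≤-refl
  len-monotone (≤′-step h) = ≤-trans (len-monotone h) (len-mono _)

  pre-stable : ∀ {s s'} → s ≤′ s' → AgreeBelow (len s) (pre s') (pre s)
  pre-stable ≤′-refl     t _   = refl
  pre-stable (≤′-step h) t t<L = trans (coherent _ t (<-≤-trans t<L (len-monotone h))) (pre-stable h t t<L)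

  limit-agrees : ∀ s → AgreeBelow (len s) limit (pre s)
  limit-agrees s t t<L with ≤-total s (suc t)
  ... | inj₁ s≤1+t = pre-stable (≤⇒≤′ s≤1+t) t t<L
  ... | inj₂ 1+t≤s = sym (pre-stable (≤⇒≤′ 1+t≤s) t (len-unbounded (suc t)))

∈⇒≤max : ∀ {x xs} → x ∈ xs → x ≤ max 0 xs
∈⇒≤max {xs = xs} = All.lookup (xs≤max 0 xs)

prefixList : (ℕ → ℕ) → ℕ → List ℕ
prefixList f L = map f (upTo L)

∈-prefixList⁺ : ∀ {f L t} → t < L → f t ∈ prefixList f L
∈-prefixList⁺ t<L = ∈-map⁺ _ (∈-upTo⁺ t<L)

∈-prefixList⁻ : ∀ {f L x} → x ∈ prefixList f L → ∃ λ t → t < L × f t ≡ x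
∈-prefixList⁻ {f} x∈ with t , t∈ , refl ← ∈-map⁻ f x∈ = t , ∈-upTo⁻ t∈ , refl

incrementHead : List ℕ → List ℕ
incrementHead []       = []
incrementHead (a ∷ xs) = suc a ∷ xs

decodeᵇ : ℕᵇ → List ℕ
decodeᵇ 0ᵇ       = []
decodeᵇ 1+[2 b ] = 0 ∷ decodeᵇ b
decodeᵇ 2[1+ b ] = incrementHead (decodeᵇ b)

consᵇ : ℕ → ℕᵇ → ℕᵇ
consᵇ zero    b = 1+[2 b ]
consᵇ (suc a) b = 2[1+ consᵇ a b ]

encodeᵇ : List ℕ → ℕᵇ
encodeᵇ []       = 0ᵇ
encodeᵇ (a ∷ xs) = consᵇ a (encodeᵇ xs)

decodeᵇ-consᵇ : ∀ a b → decodeᵇ (consᵇ a b) ≡ a ∷ decodeᵇ b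
decodeᵇ-consᵇ zero    b = refl
decodeᵇ-consᵇ (suc a) b = cong incrementHead (decodeᵇ-consᵇ a b)

decodeᵇ-encodeᵇ : ∀ xs → decodeᵇ (encodeᵇ xs) ≡ xs
decodeᵇ-encodeᵇ []       = refl
decodeᵇ-encodeᵇ (a ∷ xs) =
  trans (decodeᵇ-consᵇ a (encodeᵇ xs)) (cong (a ∷_) (decodeᵇ-encodeᵇ xs))

decode : ℕ → List ℕ
decode = decodeᵇ ∘ fromℕ

encode : List ℕ → ℕ
encode = toℕ ∘ encodeᵇ

decode-encode : ∀ xs → decode (encode xs) ≡ xs
decode-encode xs = trans (cong decodeᵇ (fromℕ-toℕ (encodeᵇ xs))) (decodeᵇ-encodeᵇ xs)

-- Block m is [blockStart m, blockStart m + m].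
blockStart : ℕ → ℕ
blockStart zero    = 0
blockStart (suc m) = blockStart m + suc m

advance : ℕ × ℕ → ℕ × ℕ
advance (m , p) = if does (p ≟ m) then (suc m , 0) else (m , suc p)

advance-last : ∀ m → advance (m , m) ≡ (suc m , 0)
advance-last m = cong (λ b → if b then (suc m , 0) else (m , suc m)) (dec-true (m ≟ m) refl)

advance-inner : ∀ {m p} → p < m → advance (m , p) ≡ (m , suc p)
advance-inner {m} {p} p<m = cong (λ b → if b then (suc m , 0) else (m , suc p)) (dec-false (p ≟ m) (<⇒≢ p<m))

locate : ℕ → ℕ × ℕ
locate zero    = 0 , 0
locate (suc x) = advance (locate x)

level : ℕ → ℕ
level = proj₂ ∘ locate

locate-blockStart+ : ∀ m p → p ≤ m → locate (blockStart m + p) ≡ (m , p)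
locate-blockStart+ zero    zero    z≤n = refl
locate-blockStart+ (suc m) zero    _   = begin
  locate (blockStart m + suc m + 0)   ≡⟨ cong locate (trans (+-identityʳ _) (+-suc (blockStart m) m)) ⟩
  advance (locate (blockStart m + m)) ≡⟨ cong advance (locate-blockStart+ m m ≤-refl) ⟩
  advance (m , m)                     ≡⟨ advance-last m ⟩
  (suc m , 0)                         ∎
  where open ≡-Reasoning
locate-blockStart+ m       (suc p) p<m = begin
  locate (blockStart m + suc p)       ≡⟨ cong locate (+-suc (blockStart m) p) ⟩
  advance (locate (blockStart m + p)) ≡⟨ cong advance (locate-blockStart+ m p (<⇒≤ p<m)) ⟩
  advance (m , p)                     ≡⟨ advance-inner p<m ⟩
  (m , suc p)                         ∎
  where open ≡-Reasoning

level-blockStart+ : ∀ {m p} → p ≤ m → level (blockStart m + p) ≡ p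
level-blockStart+ {m} {p} p≤m = cong proj₂ (locate-blockStart+ m p p≤m)

level-blockStart : ∀ m → level (blockStart m) ≡ 0
level-blockStart m = trans (cong level (sym (+-identityʳ (blockStart m)))) (level-blockStart+ {m} z≤n)

m≤blockStart : ∀ m → m ≤ blockStart m
m≤blockStart zero    = z≤n
m≤blockStart (suc m) = m≤n+m (suc m) (blockStart m)

-- Position 0 is left out: level 0 lies in every world, so it cannot be protected.
InBlock : ℕ → ℕ → Set
InBlock m x = ∃ λ p → p < m × x ≡ blockStart m + suc p

dec-true⁻ : ∀ {P : Set} (P? : Dec P) → does P? ≡ true → P
dec-true⁻ (yes p) _ = p

opaque
  world : List ℕ → Subset
  world []       x = true
  world (i ∷ xs) x = does (level x ≤? i ⊎-dec x ∈? xs)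

  world-[] : ∀ x → world [] x ≡ true
  world-[] x = refl

  world-∷⁺ : ∀ {i xs x} → level x ≤ i ⊎ x ∈ xs → world (i ∷ xs) x ≡ true
  world-∷⁺ {i} {xs} {x} = dec-true (level x ≤? i ⊎-dec x ∈? xs)

  world-∷⁻ : ∀ {i xs x} → world (i ∷ xs) x ≡ true → level x ≤ i ⊎ x ∈ xs
  world-∷⁻ {i} {xs} {x} = dec-true⁻ (level x ≤? i ⊎-dec x ∈? xs)

world-blockStart : ∀ xs m → world xs (blockStart m) ≡ true
world-blockStart []       m = world-[] (blockStart m)
world-blockStart (i ∷ xs) m = world-∷⁺ (inj₁ (subst (_≤ i) (sym (level-blockStart m)) z≤n))

world-infinite : ∀ xs → Infinite (world xs)
world-infinite xs n = blockStart n , m≤blockStart n , world-blockStart xs n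

collection : Collection
collection = world ∘ decode

Generates : Algorithm → Subset → Set
Generates A K = ∀ (w : ℕ → ℕ) → Enumerates w K →
  ∃ λ T → ∀ t → T ≤ t → ∀ x → x ∈ outputs A w t → (K x ≡ true) × ¬ InS w t x

generates-world : ∀ {A} → GeneratesInLimit collection A → ∀ xs → Generates A (world xs)
generates-world {A} gen xs = subst (Generates A ∘ world) (decode-encode xs) (gen (encode xs))

retract : Subset → ℕ → ℕ → ℕ
retract K d x = if K x then x else d

retract-∈ : ∀ (K : Subset) {d} x → K d ≡ true → K (retract K d x) ≡ true
retract-∈ K x Kd with K x in Kx
... | true  = Kx
... | false = Kd

retract-fixed : ∀ (K : Subset) {d x} → K x ≡ true → retract K d x ≡ x
retract-fixed K {d} {x} Kx = cong (λ b → if b then x else d) Kx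

InS-cong : ∀ {w w' t x} → AgreeBelow (suc t) w w' → InS w t x → InS w' t x
InS-cong agree (u , u≤t , refl) = u , u≤t , sym (agree u (s≤s u≤t))

InS-mono : ∀ {w t t' x} → t ≤ t' → InS w t x → InS w t' x
InS-mono t≤t' (u , u≤t , wu≡x) = u , ≤-trans u≤t t≤t' , wu≡x

outputs-cong : ∀ A {w w'} t → AgreeBelow (suc t) w w' → outputs A w t ≡ outputs A w' t
outputs-cong A t agree = cong A (map-cong-local (All.tabulate (λ u∈ → agree _ (∈-upTo⁻ u∈))))

countBelow-all : ∀ {K} → (∀ x → K x ≡ true) → ∀ b → countBelow K b ≡ b
countBelow-all all zero    = refl
countBelow-all all (suc b) rewrite all b = cong suc (countBelow-all all b)

IsNth-all : ∀ {K i b} → (∀ x → K x ≡ true) → IsNth K i b → b ≡ i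
IsNth-all {b = b} all (_ , count≡i) = trans (sym (countBelow-all all b)) count≡i

countIn-none : ∀ {P : ℕ → Set} {xs} → All.All (¬_ ∘ P) xs → CountIn P xs 0
countIn-none All.[]         = c-nil
countIn-none (¬Px All.∷ ps) = c-no ¬Px (countIn-none ps)

∈-window⁻ : ∀ {m k i} → i ∈ window m k → ∃ λ u → u < k × i ≡ m + u
∈-window⁻ {m} i∈ with u , u∈ , refl ← ∈-map⁻ (m +_) i∈ = u , ∈-upTo⁻ u∈ , refl

density-zero-from-gaps : ∀ {P : ℕ → Set} {K} →
  (∀ k → ∃ λ m → ∀ {u b} → u < k → IsNth K (m + u) b → ¬ P b) → BanachDensityZero P K
density-zero-from-gaps {P} {K} gaps n _ k₀ with m , gap ← gaps (suc k₀) =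
  suc k₀ , n≤1+n k₀ , m , 0 , countIn-none (All.tabulate no-hit) ,
  subst (_< suc k₀) (sym (*-zeroʳ n)) (s≤s z≤n)
  where
    no-hit : ∀ {i} → i ∈ window m (suc k₀) → ¬ ∃ λ b → IsNth K i b × P b
    no-hit i∈ (b , nth , Pb) with u , u<k , refl ← ∈-window⁻ i∈ = gap u<k nth Pb

module _ (A : Algorithm) where

  record CleanBlock (i : ℕ) (e f : ℕ → ℕ) (L N : ℕ) : Set where
    field
      time block       : ℕ
      N≤time           : N ≤ time
      N≤block          : N ≤ block
      prefix<block     : ∀ t → t < L → f t < blockStart block
      revealed         : ∀ p → p < i → InS e time (blockStart block + suc p)
      outputs-revealed : ∀ t → t ≤ time → ∀ x → x ∈ outputs A e t → InBlock block x → InS e t x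

  record Adversary (i : ℕ) (f : ℕ → ℕ) (L : ℕ) : Set where
    field
      enum       : ℕ → ℕ
      extends    : AgreeBelow L enum f
      enumerates : Enumerates enum (world (i ∷ prefixList f L))
      clean      : ∀ N → CleanBlock i enum f L N

  module Base (f : ℕ → ℕ) (L : ℕ) where

    W : Subset
    W = world (0 ∷ prefixList f L)

    enum : ℕ → ℕ
    enum = splice f L (retract W 0)

    enumerates : Enumerates enum W
    enumerates =
      splice-All {λ y → W y ≡ true} f L _
        (λ t t<L → world-∷⁺ (inj₂ (∈-prefixList⁺ t<L))) (λ u → retract-∈ W u (world-∷⁺ (inj₁ z≤n))) ,
      λ x Wx → L + x , trans (splice-+ f L _ x) (retract-fixed W Wx)

    clean : ∀ N → CleanBlock 0 enum f L N
    clean N = record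
      { time             = N
      ; block            = M
      ; N≤time           = ≤-refl
      ; N≤block          = m≤m+n N _
      ; prefix<block     = λ t t<L → below-block (∈-++⁺ˡ (∈-prefixList⁺ t<L))
      ; revealed         = λ _ ()
      ; outputs-revealed = λ t t≤N x x∈ → λ { (p , _ , refl) →
          ⊥-elim (<⇒≱ (below-block (output-observed t≤N x∈)) (m≤m+n _ (suc p))) }
      }
      where
        observed : List ℕ
        observed = prefixList f L ++ concat (map (outputs A enum) (upTo (suc N)))
        M : ℕ
        M = N + suc (max 0 observed)
        below-block : ∀ {x} → x ∈ observed → x < blockStart M
        below-block x∈ = <-≤-trans (s≤s (∈⇒≤max x∈)) (≤-trans (m≤n+m _ N) (m≤blockStart M))
        output-observed : ∀ {t x} → t ≤ N → x ∈ outputs A enum t → x ∈ observed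
        output-observed t≤N x∈ =
          ∈-++⁺ʳ (prefixList f L) (∈-concat⁺′ x∈ (∈-map⁺ (outputs A enum) (∈-upTo⁺ (s≤s t≤N))))

    adversary : Adversary 0 f L
    adversary = record { enum = enum ; extends = splice-< f L _ ; enumerates = enumerates ; clean = clean }

  -- Stage s hands the current prefix to an adversary of rank (rank s), follows it until its
  -- clean block is complete, then reveals position rank s + 1 of that block and, if it lies in W, s.
  module Iteration (W : Subset) (rank : ℕ → ℕ) (adv : ∀ s g M → Adversary (rank s) g M)
                   (f : ℕ → ℕ) (L : ℕ) where

    demand : ℕ → ℕ → ℕ
    demand s M = M + s + suc (rank s)

    appended : ℕ → ℕ → ℕ → ℕ
    appended s m zero    = blockStart m + suc (rank s)
    appended s m (suc _) = retract W 0 s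

    extend : ℕ → (ℕ → ℕ) × ℕ → (ℕ → ℕ) × ℕ
    extend s (g , M) =
      splice (Adversary.enum a) (suc (CleanBlock.time c)) (appended s (CleanBlock.block c)) ,
      suc (CleanBlock.time c) + 2
      where
        a : Adversary (rank s) g M
        a = adv s g M
        c : CleanBlock (rank s) (Adversary.enum a) g M (demand s M)
        c = Adversary.clean a (demand s M)

    stage : ℕ → (ℕ → ℕ) × ℕ
    stage zero    = f , L
    stage (suc s) = extend s (stage s)

    pre : ℕ → ℕ → ℕ
    pre = proj₁ ∘ stage

    len : ℕ → ℕ
    len = proj₂ ∘ stage

    inner : ∀ s → Adversary (rank s) (pre s) (len s)
    inner s = adv s (pre s) (len s)

    innerEnum : ℕ → ℕ → ℕ
    innerEnum s = Adversary.enum (inner s)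

    innerClean : ∀ s → CleanBlock (rank s) (innerEnum s) (pre s) (len s) (demand s (len s))
    innerClean s = Adversary.clean (inner s) (demand s (len s))

    time block : ℕ → ℕ
    time  s = CleanBlock.time (innerClean s)
    block s = CleanBlock.block (innerClean s)

    len≤time : ∀ s → len s ≤ time s
    len≤time s = ≤-trans (≤-trans (m≤m+n (len s) s) (m≤m+n _ _)) (CleanBlock.N≤time (innerClean s))

    s≤time : ∀ s → s ≤ time s
    s≤time s = ≤-trans (≤-trans (m≤n+m s (len s)) (m≤m+n _ _)) (CleanBlock.N≤time (innerClean s))

    s≤block : ∀ s → s ≤ block s
    s≤block s = ≤-trans (≤-trans (m≤n+m s (len s)) (m≤m+n _ _)) (CleanBlock.N≤block (innerClean s))

    rank<block : ∀ s → rank s < block s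
    rank<block s = ≤-trans (m≤n+m _ (len s + s)) (CleanBlock.N≤block (innerClean s))

    pre-suc-inner : ∀ s → AgreeBelow (suc (time s)) (pre (suc s)) (innerEnum s)
    pre-suc-inner s = splice-< (innerEnum s) (suc (time s)) (appended s (block s))

    coherent : ∀ s → AgreeBelow (len s) (pre (suc s)) (pre s)
    coherent s t t<len = trans (pre-suc-inner s t (<-≤-trans t<len (≤-trans (len≤time s) (n≤1+n _))))
                               (Adversary.extends (inner s) t t<len)

    len-mono : ∀ s → len s ≤ len (suc s)
    len-mono s = ≤-trans (len≤time s) (≤-trans (n≤1+n _) (m≤m+n _ 2))

    len-unbounded : ∀ s → s ≤ len s
    len-unbounded zero    = z≤n
    len-unbounded (suc s) = s≤s (≤-trans (s≤time s) (m≤m+n _ 2))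

    open PrefixLimit pre len coherent len-mono len-unbounded public
      renaming (limit to enum)

    enum-inner : ∀ s → AgreeBelow (suc (time s)) enum (innerEnum s)
    enum-inner s t t≤time =
      trans (limit-agrees (suc s) t (≤-trans t≤time (m≤m+n _ 2))) (pre-suc-inner s t t≤time)

    enum-appended : ∀ s u → u < 2 → enum (suc (time s) + u) ≡ appended s (block s) u
    enum-appended s u u<2 = trans (limit-agrees (suc s) _ (+-monoʳ-< (suc (time s)) u<2))
                                  (splice-+ (innerEnum s) (suc (time s)) (appended s (block s)) u)

    enumerates : (∀ t → t < L → W (f t) ≡ true) → (∀ s x → level x ≤ suc (rank s) → W x ≡ true) →
                 Enumerates enum W
    enumerates prefix⊆W levels⊆W =
      (λ t → stage⊆W (suc t) t (len-unbounded (suc t))) ,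
      λ x Wx → suc (time x) + 1 , trans (enum-appended x 1 ≤-refl) (retract-fixed W Wx)
      where
        stage⊆W : ∀ s t → t < len s → W (pre s t) ≡ true
        stage⊆W zero        = prefix⊆W
        stage⊆W (suc s) t _ =
          splice-All {λ y → W y ≡ true} (innerEnum s) (suc (time s)) (appended s (block s))
                     (λ t _ → inner⊆W t) appended⊆W t
          where
            inner⊆W : ∀ t → W (innerEnum s t) ≡ true
            inner⊆W t with world-∷⁻ (proj₁ (Adversary.enumerates (inner s)) t)
            ... | inj₁ low = levels⊆W s _ (m≤n⇒m≤1+n low)
            ... | inj₂ x∈  with u , u<len , pre≡ ← ∈-prefixList⁻ x∈ =
              subst (λ y → W y ≡ true) pre≡ (stage⊆W s u u<len)
            appended⊆W : ∀ u → W (appended s (block s) u) ≡ true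
            appended⊆W zero    = levels⊆W s _ (≤-reflexive (level-blockStart+ (rank<block s)))
            appended⊆W (suc _) = retract-∈ W s (levels⊆W s 0 z≤n)

    early<block : ∀ s u → u < len s → enum u < blockStart (block s)
    early<block s u u<len = subst (_< blockStart (block s)) (sym (limit-agrees s u u<len))
                                  (CleanBlock.prefix<block (innerClean s) u u<len)

    block-unrevealed : ∀ s {t x} → t < len s → InBlock (block s) x → ¬ InS enum t x
    block-unrevealed s t<len (p , _ , refl) (u , u≤t , enum-u≡x) =
      <⇒≱ (early<block s u (≤-<-trans u≤t t<len))
          (subst (blockStart (block s) ≤_) (sym enum-u≡x) (m≤m+n _ (suc p)))

    revealed : ∀ s p → p < rank s → InS enum (time s) (blockStart (block s) + suc p)
    revealed s p p<rank =
      InS-cong (λ t t≤time → sym (enum-inner s t t≤time)) (CleanBlock.revealed (innerClean s) p p<rank)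

    outputs-revealed : ∀ s t → t ≤ time s → ∀ x → x ∈ outputs A enum t → InBlock (block s) x → InS enum t x
    outputs-revealed s t t≤time x x∈ x∈B =
      InS-cong (λ u u≤t → sym (agree u u≤t))
        (CleanBlock.outputs-revealed (innerClean s) t t≤time x
          (subst (x ∈_) (outputs-cong A t agree) x∈) x∈B)
      where
        agree : AgreeBelow (suc t) enum (innerEnum s)
        agree u u≤t = enum-inner s u (<-≤-trans u≤t (s≤s t≤time))

  module _ (gen : GeneratesInLimit collection A) where

    module Step (i : ℕ) (adv : ∀ g M → Adversary i g M) (f : ℕ → ℕ) (L : ℕ) where

      W : Subset
      W = world (suc i ∷ prefixList f L)

      open Iteration W (λ _ → i) (λ _ → adv) f L

      enumerates-W : Enumerates enum W
      enumerates-W =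
        enumerates (λ t t<L → world-∷⁺ (inj₂ (∈-prefixList⁺ t<L))) (λ _ _ low → world-∷⁺ (inj₁ low))

      T : ℕ
      T = proj₁ (generates-world {A} gen (suc i ∷ prefixList f L) enum enumerates-W)

      outputs-in-W : ∀ t → T ≤ t → ∀ x → x ∈ outputs A enum t → W x ≡ true
      outputs-in-W t T≤t x x∈ = proj₁ (proj₂ (generates-world {A} gen _ enum enumerates-W) t T≤t x x∈)

      L≤len : ∀ s → L ≤ len s
      L≤len s = len-monotone {0} {s} (≤⇒≤′ z≤n)

      revealed-next : ∀ s p → p < suc i → InS enum (suc (time s)) (blockStart (block s) + suc p)
      revealed-next s p p<1+i with m<1+n⇒m<n∨m≡n p<1+i
      ... | inj₁ p<i  = InS-mono (n≤1+n _) (revealed s p p<i)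
      ... | inj₂ refl = suc (time s) + 0 , ≤-reflexive (+-identityʳ _) , enum-appended s 0 (s≤s z≤n)

      W∩block-revealed : ∀ s x → W x ≡ true → InBlock (block s) x → InS enum (suc (time s)) x
      W∩block-revealed s x Wx x∈B@(p , p<block , refl) with world-∷⁻ Wx
      ... | inj₁ low = revealed-next s p (≤-trans (≤-reflexive (sym (level-blockStart+ p<block))) low)
      ... | inj₂ x∈  with u , u<L , fu≡x ← ∈-prefixList⁻ x∈ =
        ⊥-elim (block-unrevealed s (<-≤-trans u<L (L≤len s)) x∈B
                                 (u , ≤-refl , trans (limit-agrees 0 u u<L) fu≡x))

      clean : ∀ N → CleanBlock (suc i) enum f L N
      clean N = record
        { time             = suc (time s)
        ; block            = block s
        ; N≤time           = ≤-trans N≤s (≤-trans (s≤time s) (n≤1+n _))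
        ; N≤block          = ≤-trans N≤s (s≤block s)
        ; prefix<block     = λ t t<L → subst (_< blockStart (block s)) (limit-agrees 0 t t<L)
                                             (early<block s t (<-≤-trans t<L (L≤len s)))
        ; revealed         = revealed-next s
        ; outputs-revealed = outputs-revealed-next
        }
        where
          s : ℕ
          s = N + T
          N≤s : N ≤ s
          N≤s = m≤m+n N T
          T< : ∀ {t} → time s < t → T ≤ t
          T< time<t = ≤-trans (m≤n+m T N) (≤-trans (s≤time s) (<⇒≤ time<t))
          outputs-revealed-next : ∀ t → t ≤ suc (time s) → ∀ x → x ∈ outputs A enum t →
                                  InBlock (block s) x → InS enum t x
          outputs-revealed-next t _ x x∈ x∈B =
            [ (λ t≤time → outputs-revealed s t t≤time x x∈ x∈B)
            , (λ time<t → InS-mono time<t (W∩block-revealed s x (outputs-in-W t (T< time<t) x x∈) x∈B))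
            ]′ (≤-<-connex t (time s))

      adversary : Adversary (suc i) f L
      adversary = record { enum = enum ; extends = limit-agrees 0 ; enumerates = enumerates-W ; clean = clean }

    adversary : ∀ i f L → Adversary i f L
    adversary zero    = Base.adversary
    adversary (suc i) = Step.adversary i (adversary i)

    module Diagonal where

      open Iteration (world []) (λ s → s) adversary (λ _ → 0) 0 public

      enumerates-ℕ : Enumerates enum (world [])
      enumerates-ℕ = enumerates (λ _ ()) (λ _ x _ → world-[] x)

      T : ℕ
      T = proj₁ (generates-world {A} gen [] enum enumerates-ℕ)

      outputs-fresh : ∀ t → T ≤ t → ∀ x → x ∈ outputs A enum t → ¬ InS enum t x
      outputs-fresh t T≤t x x∈ = proj₂ (proj₂ (generates-world {A} gen [] enum enumerates-ℕ) t T≤t x x∈)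

      never-output : ∀ s → T ≤ s → ∀ p → p < s → ∀ t → ¬ blockStart (block s) + suc p ∈ outputs A enum t
      never-output s T≤s p p<s t x∈ =
        [ (λ t<T → block-unrevealed s (<-≤-trans t<T (≤-trans T≤s (len-unbounded s))) x∈B x∈S)
        , (λ T≤t → outputs-fresh t T≤t _ x∈ x∈S)
        ]′ (<-≤-connex t T)
        where
          x∈B : InBlock (block s) (blockStart (block s) + suc p)
          x∈B = p , <-≤-trans p<s (s≤block s) , refl
          x∈S : InS enum t (blockStart (block s) + suc p)
          x∈S = [ (λ t≤time → outputs-revealed s t t≤time _ x∈ x∈B)
                , (λ time<t → InS-mono (<⇒≤ time<t) (revealed s p p<s))
                ]′ (≤-<-connex t (time s))

      density : BanachDensityZero (InO A enum) (world [])
      density = density-zero-from-gaps λ k → suc (blockStart (block (k + T))) , λ {u} u<k nth (t , b∈) →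
        never-output (k + T) (m≤n+m T k) u (≤-trans u<k (m≤m+n k T)) t
          (subst (_∈ outputs A enum t) (trans (IsNth-all world-[] nth) (sym (+-suc _ u))) b∈)

corollary3p3 : (C : ℕ) → 1 ≤ C →
    ∃ λ (X : Collection) → (∀ j → Infinite (X j)) ×
      (∀ (A : Algorithm) → HasSpeed C A → GeneratesInLimit X A →
        ∃ λ j → ∃ λ (w : ℕ → ℕ) → Enumerates w (X j) ×
          BanachDensityZero (InO A w) (X j))
corollary3p3 C _ = collection , world-infinite ∘ decode , λ A _ gen →
  0 , Diagonal.enum A gen , Diagonal.enumerates-ℕ A gen , Diagonal.density A gen
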